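{- Let $G$ be a graph without isolated vertices with $\sigma(G)=1$. Then $\sigma(G+P_k)=1$ for every $k\ge 2$.
   Context: A graph $H=(V,E)$ is a sum graph if there is an injective map $\lambda:V\to\mathbb{N}$ with $E=\{xy : \exists z\in V,\ \lambda(z)=\lambda(x)+\lambda(y)\}$. For a graph $G$ without isolated vertices, $\sigma(G)$ is the minimum $k$ such that $G+N_k$ is a sum graph ($N_k$: $k$ isolated vertices, $+$: disjoint union). $P_k$ is the path on $k$ vertices. -}

module Defs where

open import Level using (0ℓ)
open import Data.Nat using (ℕ; zero; suc; _+_; _<_; NonZero)
open import Data.Nat.Properties using (n<1+n; <-irrefl)
open import Data.Fin using (Fin; toℕ; splitAt)
open import Data.Sum using (_⊎_; inj₁; inj₂; swap)
open import Data.Product using (_×_; ∃; ∃-syntax; _,_)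
open import Data.Empty using (⊥)
open import Relation.Nullary using (¬_)
open import Relation.Binary.PropositionalEquality using (_≡_; _≢_; sym)
open import Function.Bundles using (_⇔_)
open import Function.Definitions using (Injective)

record Graph : Set₁ where
  field
    V      : ℕ
    E      : Fin V → Fin V → Set
    E-sym  : ∀ {x y} → E x y → E y x
    E-irr  : ∀ {x} → ¬ E x x
open Graph public

NoIsolated : Graph → Set
NoIsolated G = ∀ (x : Fin (V G)) → ∃[ y ] E G x y

private
  E⊎ : ∀ {n m} → (Fin n → Fin n → Set) → (Fin m → Fin m → Set) →
       Fin n ⊎ Fin m → Fin n ⊎ Fin m → Set
  E⊎ E₁ E₂ (inj₁ a) (inj₁ b) = E₁ a b
  E⊎ E₁ E₂ (inj₂ a) (inj₂ b) = E₂ a b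
  E⊎ E₁ E₂ (inj₁ _) (inj₂ _) = ⊥
  E⊎ E₁ E₂ (inj₂ _) (inj₁ _) = ⊥

  E⊎-sym : (G : Graph) (H : Graph) (p q : Fin (V G) ⊎ Fin (V H)) →
           E⊎ (E G) (E H) p q → E⊎ (E G) (E H) q p
  E⊎-sym G H (inj₁ a) (inj₁ b) e = E-sym G e
  E⊎-sym G H (inj₂ a) (inj₂ b) e = E-sym H e

  E⊎-irr : ∀ (G : Graph) (H : Graph) (p : Fin (V G) ⊎ Fin (V H)) →
           ¬ E⊎ (E G) (E H) p p
  E⊎-irr G H (inj₁ a) = E-irr G
  E⊎-irr G H (inj₂ a) = E-irr H

_⊕_ : Graph → Graph → Graph
G ⊕ H = record
  { V     = V G + V H
  ; E     = λ x y → E⊎ (E G) (E H) (splitAt (V G) x) (splitAt (V G) y)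
  ; E-sym = λ {x} {y} → E⊎-sym G H (splitAt (V G) x) (splitAt (V G) y)
  ; E-irr = λ {x} → E⊎-irr G H (splitAt (V G) x)
  }

N : ℕ → Graph
N k = record { V = k ; E = λ _ _ → ⊥ ; E-sym = λ () ; E-irr = λ () }

P : ℕ → Graph
P k = record
  { V     = k
  ; E     = λ i j → (suc (toℕ i) ≡ toℕ j) ⊎ (suc (toℕ j) ≡ toℕ i)
  ; E-sym = swap
  ; E-irr = λ { {x} (inj₁ e) → <-irrefl (sym e) (n<1+n (toℕ x))
              ; {x} (inj₂ e) → <-irrefl (sym e) (n<1+n (toℕ x)) }
  }

IsSumGraph : Graph → Set
IsSumGraph H =
  ∃[ lab ] ( (∀ x → NonZero (lab x))
           × Injective _≡_ _≡_ lab
           × (∀ (x y : Fin (V H)) → x ≢ y →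
                (E H x y ⇔ (∃[ z ] lab z ≡ lab x + lab y))) )

HasSumNumber : Graph → ℕ → Set
HasSumNumber G k = IsSumGraph (G ⊕ N k) × (∀ j → j < k → ¬ IsSumGraph (G ⊕ N j))

{-# OPTIONS --safe #-}
-- Let l label G + N₁ as a sum graph, with a the label of the isolated vertex and
-- M the largest label.  Label the path P_k by q₀ = a, q₁ = 2M + 1 and
-- q_{m+2} = q_m + q_{m+1}, and the new isolated vertex by q_k.  Sums of two
-- G-labels stay below q₁, so the edges of G are witnessed exactly as before (the
-- role of the old isolated vertex being taken over by the first path vertex).
-- Every other sum lies strictly between two consecutive q's, or above q_k,
-- unless it is q_i + q_{i+1} = q_{i+2}, which is precisely a path edge.
-- Conversely, no graph without isolated vertices is a sum graph: an edge at a
-- vertex of maximum label would need an even larger label.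
module Submission where

open import Defs
open import Data.Nat.Base using (ℕ; _≤_; zero; suc; _+_; _<_; z≤n; s≤s; NonZero; >-nonZero; >-nonZero⁻¹)
open import Data.Nat.Properties
open import Data.Fin.Base using (Fin; toℕ; splitAt; _↑ˡ_; _↑ʳ_; fromℕ<; inject₁)
  renaming (zero to fzero; suc to fsuc)
open import Data.Fin.Properties
  using (splitAt-↑ˡ; splitAt-↑ʳ; splitAt⁻¹-↑ˡ; splitAt⁻¹-↑ʳ; ↑ˡ-injective; toℕ-fromℕ<; toℕ-inject₁; toℕ-injective; toℕ<n)
open import Data.Vec.Functional using (_++_)
open import Data.Vec.Functional.Properties using (lookup-++ˡ; lookup-++ʳ)
open import Data.List.Base using (allFin)
open import Data.List.Extrema.Nat using (argmax; f[xs]≤f[argmax])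
open import Data.List.Membership.Propositional.Properties using (∈-allFin)
import Data.List.Relation.Unary.All as All
open import Data.Sum.Base using (_⊎_; inj₁; inj₂)
open import Data.Product.Base using (∃-syntax; _×_; _,_; proj₁; proj₂)
open import Data.Empty using (⊥-elim)
open import Relation.Nullary using (¬_; yes; no)
open import Relation.Binary.PropositionalEquality
open import Relation.Binary.Definitions using (tri<; tri≈; tri>)
open import Function.Base using (_∘_)
open import Function.Bundles using (_⇔_; mk⇔; Equivalence)
open import Function.Definitions using (Injective)
open import Function.Properties.Equivalence using () renaming (refl to ⇔-refl; trans to ⇔-trans)

open Equivalence

⇔-of-¬ : ∀ {A B : Set} → ¬ A → ¬ B → A ⇔ B
⇔-of-¬ ¬a ¬b = mk⇔ (⊥-elim ∘ ¬a) (⊥-elim ∘ ¬b)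

argmax-Fin : ∀ {n} (f : Fin n → ℕ) → Fin n → ∃[ x ] (∀ y → f y ≤ f x)
argmax-Fin {n} f x₀ =
  argmax f x₀ (allFin n) , λ y → All.lookup (f[xs]≤f[argmax] x₀ (allFin n)) (∈-allFin y)

data SplitView (m n : ℕ) : Fin (m + n) → Set where
  left  : (i : Fin m) → SplitView m n (i ↑ˡ n)
  right : (j : Fin n) → SplitView m n (m ↑ʳ j)

splitView : ∀ m {n} (x : Fin (m + n)) → SplitView m n x
splitView m x with splitAt m x in eq
... | inj₁ i = subst (SplitView m _) (splitAt⁻¹-↑ˡ eq) (left i)
... | inj₂ j = subst (SplitView m _) (splitAt⁻¹-↑ʳ eq) (right j)

↑ˡ≢↑ʳ : ∀ {m n} (i : Fin m) (j : Fin n) → i ↑ˡ n ≢ m ↑ʳ j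
↑ˡ≢↑ʳ {m} {n} i j eq
  with trans (sym (splitAt-↑ˡ m i n)) (trans (cong (splitAt m) eq) (splitAt-↑ʳ m n j))
... | ()

module _ {G H : Graph} where

  ⊕-E-↑ˡ : ∀ (x y : Fin (V G)) → E (G ⊕ H) (x ↑ˡ V H) (y ↑ˡ V H) ⇔ E G x y
  ⊕-E-↑ˡ x y rewrite splitAt-↑ˡ (V G) x (V H) | splitAt-↑ˡ (V G) y (V H) = ⇔-refl

  ⊕-E-↑ʳ : ∀ (x y : Fin (V H)) → E (G ⊕ H) (V G ↑ʳ x) (V G ↑ʳ y) ⇔ E H x y
  ⊕-E-↑ʳ x y rewrite splitAt-↑ʳ (V G) (V H) x | splitAt-↑ʳ (V G) (V H) y = ⇔-refl

  ⊕-¬E-↑ˡ-↑ʳ : ∀ (x : Fin (V G)) (y : Fin (V H)) → ¬ E (G ⊕ H) (x ↑ˡ V H) (V G ↑ʳ y)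
  ⊕-¬E-↑ˡ-↑ʳ x y rewrite splitAt-↑ˡ (V G) x (V H) | splitAt-↑ʳ (V G) (V H) y = λ ()

  NoIsolated-⊕ : NoIsolated G → NoIsolated H → NoIsolated (G ⊕ H)
  NoIsolated-⊕ noG noH x with splitView (V G) x
  ... | left i  = proj₁ (noG i) ↑ˡ V H , from (⊕-E-↑ˡ i _) (proj₂ (noG i))
  ... | right j = V G ↑ʳ proj₁ (noH j) , from (⊕-E-↑ʳ j _) (proj₂ (noH j))

NoIsolated-P : ∀ {k} → 2 ≤ k → NoIsolated (P k)
NoIsolated-P (s≤s (s≤s z≤n)) fzero    = fsuc fzero , inj₁ refl
NoIsolated-P (s≤s (s≤s z≤n)) (fsuc i) = inject₁ i , inj₂ (cong suc (toℕ-inject₁ i))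

NoIsolated⇒¬IsSumGraph : (H : Graph) → NoIsolated H → Fin (V H) → ¬ IsSumGraph H
NoIsolated⇒¬IsSumGraph H noH x₀ (lab , nonZero , _ , sum⇔E)
  with argmax-Fin lab x₀
... | x , lab≤labx with noH x
... | y , xy with to (sum⇔E x y (λ { refl → E-irr H xy })) xy
... | z , labz≡labx+laby =
  <⇒≱ (subst (lab x <_) (sym labz≡labx+laby) (m<m+n (lab x) (>-nonZero⁻¹ (lab y) {{nonZero y}})))
      (lab≤labx z)

σ-positive : (H : Graph) → NoIsolated H → Fin (V H) → ∀ j → j < 1 → ¬ IsSumGraph (H ⊕ N j)
σ-positive H noH x₀ zero _ =
  NoIsolated⇒¬IsSumGraph (H ⊕ N 0) (NoIsolated-⊕ {H} {N 0} noH (λ ())) (x₀ ↑ˡ 0)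
σ-positive H noH x₀ (suc j) (s≤s ())

module AdditiveRecurrence (a b : ℕ) (0<a : 0 < a) (a<b : a < b) where

  q : ℕ → ℕ
  q zero          = a
  q (suc zero)    = b
  q (suc (suc m)) = q m + q (suc m)

  q-positive : ∀ m → 0 < q m
  q-positive zero          = 0<a
  q-positive (suc zero)    = <-trans 0<a a<b
  q-positive (suc (suc m)) = <-≤-trans (q-positive m) (m≤m+n (q m) (q (suc m)))

  q-<-suc : ∀ m → q m < q (suc m)
  q-<-suc zero    = a<b
  q-<-suc (suc m) = m<n+m (q (suc m)) (q-positive m)

  q-strictMono : ∀ {m j} → m < j → q m < q j
  q-strictMono {m} {suc j} m<1+j with m<1+n⇒m<n∨m≡n m<1+j
  ... | inj₁ m<j  = <-trans (q-strictMono m<j) (q-<-suc j)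
  ... | inj₂ refl = q-<-suc m

  q-mono : ∀ {m j} → m ≤ j → q m ≤ q j
  q-mono m≤j with m≤n⇒m<n∨m≡n m≤j
  ... | inj₁ m<j  = <⇒≤ (q-strictMono m<j)
  ... | inj₂ refl = ≤-refl

  q-injective : ∀ {m j} → q m ≡ q j → m ≡ j
  q-injective {m} {j} eq with <-cmp m j
  ... | tri< m<j _ _ = ⊥-elim (<⇒≢ (q-strictMono m<j) eq)
  ... | tri≈ _ m≡j _ = m≡j
  ... | tri> _ _ j<m = ⊥-elim (<⇒≢ (q-strictMono j<m) (sym eq))

  b≤q : ∀ m → b ≤ q (suc m)
  b≤q m = q-mono {1} {suc m} (s≤s z≤n)

  q-gap : ∀ j {s} → q j < s → s < q (suc j) → ∀ m → q m ≢ s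
  q-gap j qj<s s<qj+1 m refl with m ≤? j
  ... | yes m≤j = <⇒≱ qj<s (q-mono m≤j)
  ... | no  m≰j = <⇒≱ s<qj+1 (q-mono (≰⇒> m≰j))

module PathExtension
  (G : Graph) (k : ℕ) (1≤k : 1 ≤ k) (l : Fin (V G + 1) → ℕ)
  (l-nonZero : ∀ x → NonZero (l x)) (l-injective : Injective _≡_ _≡_ l)
  (l-sum : ∀ x y → x ≢ y → (E (G ⊕ N 1) x y ⇔ (∃[ z ] l z ≡ l x + l y)))
  (M : ℕ) (l≤M : ∀ x → l x ≤ M)
  where

  n : ℕ
  n = V G

  o : Fin n → Fin (n + 1)
  o g = g ↑ˡ 1

  w : Fin (n + 1)
  w = n ↑ʳ fzero

  o≢w : ∀ g → o g ≢ w
  o≢w g = ↑ˡ≢↑ʳ g fzero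

  l-positive : ∀ x → 0 < l x
  l-positive x = >-nonZero⁻¹ (l x) {{l-nonZero x}}

  B : ℕ
  B = suc (M + M)

  l+l<B : ∀ x y → l x + l y < B
  l+l<B x y = s≤s (+-mono-≤ (l≤M x) (l≤M y))

  l<B : ∀ x → l x < B
  l<B x = ≤-<-trans (m≤m+n (l x) (l x)) (l+l<B x x)

  open AdditiveRecurrence (l w) B (l-positive w) (l<B w)

  l<q : ∀ x m → l x < q (suc m)
  l<q x m = <-≤-trans (l<B x) (b≤q m)

  Hk : Graph
  Hk = (G ⊕ P k) ⊕ N 1

  inG : Fin n → Fin (V Hk)
  inG g = (g ↑ˡ k) ↑ˡ 1

  inP : Fin k → Fin (V Hk)
  inP i = (n ↑ʳ i) ↑ˡ 1

  inN : Fin (V Hk)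
  inN = (n + k) ↑ʳ fzero

  data Piece : Fin (V Hk) → Set where
    G-vertex : (g : Fin n) → Piece (inG g)
    P-vertex : (i : Fin k) → Piece (inP i)
    N-vertex : Piece inN

  piece : ∀ x → Piece x
  piece x with splitView (n + k) x
  ... | right fzero = N-vertex
  ... | left u with splitView n u
  ...   | left g  = G-vertex g
  ...   | right i = P-vertex i

  L-GP : Fin (n + k) → ℕ
  L-GP = (l ∘ o) ++ (q ∘ toℕ)

  L : Fin (V Hk) → ℕ
  L = L-GP ++ (λ _ → q k)

  L-inG : ∀ g → L (inG g) ≡ l (o g)
  L-inG g = trans (lookup-++ˡ L-GP _ (g ↑ˡ k)) (lookup-++ˡ (l ∘ o) (q ∘ toℕ) g)

  L-inP : ∀ i → L (inP i) ≡ q (toℕ i)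
  L-inP i = trans (lookup-++ˡ L-GP _ (n ↑ʳ i)) (lookup-++ʳ (l ∘ o) (q ∘ toℕ) i)

  L-inN : L inN ≡ q k
  L-inN = lookup-++ʳ L-GP (λ _ → q k) fzero

  IsLabel : ℕ → Set
  IsLabel s = ∃[ z ] L z ≡ s

  isLabel-q : ∀ {m} → m ≤ k → IsLabel (q m)
  isLabel-q m≤k with m≤n⇒m<n∨m≡n m≤k
  ... | inj₁ m<k  = inP (fromℕ< m<k) , trans (L-inP _) (cong q (toℕ-fromℕ< m<k))
  ... | inj₂ refl = inN , L-inN

  isLabel-l : ∀ z → IsLabel (l z)
  isLabel-l z with splitView n z
  ... | left g      = inG g , L-inG g
  ... | right fzero = isLabel-q z≤n

  label-cases : ∀ {s} → IsLabel s → (∃[ z ] l z ≡ s) ⊎ (∃[ m ] m ≤ k × q m ≡ s)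
  label-cases (z , refl) with piece z
  ... | G-vertex g = inj₁ (o g , sym (L-inG g))
  ... | P-vertex i = inj₂ (toℕ i , <⇒≤ (toℕ<n i) , sym (L-inP i))
  ... | N-vertex   = inj₂ (k , ≤-refl , sym L-inN)

  isLabel<B⇒old : ∀ {s} → IsLabel s → s < B → ∃[ z ] l z ≡ s
  isLabel<B⇒old lab s<B with label-cases lab
  ... | inj₁ old                 = old
  ... | inj₂ (zero , _ , a≡s)    = w , a≡s
  ... | inj₂ (suc m , _ , refl)  = ⊥-elim (<⇒≱ s<B (b≤q m))

  ¬isLabel-above : ∀ {s} → q k < s → ¬ IsLabel s
  ¬isLabel-above qk<s lab with label-cases lab
  ... | inj₁ (z , refl)       = <-asym qk<s (<-≤-trans (l<q z 0) (q-mono 1≤k))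
  ... | inj₂ (m , m≤k , refl) = <⇒≱ qk<s (q-mono m≤k)

  ¬isLabel-gap : ∀ j {s} → q (suc j) < s → s < q (suc (suc j)) → ¬ IsLabel s
  ¬isLabel-gap j lo hi lab with label-cases lab
  ... | inj₁ (z , refl)    = <-asym lo (l<q z j)
  ... | inj₂ (m , _ , q≡s) = q-gap (suc j) lo hi m q≡s

  Adjacency : Fin (V Hk) → Fin (V Hk) → Set
  Adjacency x y = E Hk x y ⇔ IsLabel (L x + L y)

  NonAdjacent : Fin (V Hk) → Fin (V Hk) → Set
  NonAdjacent x y = ¬ E Hk x y × ¬ IsLabel (L x + L y)

  nonAdjacent-sym : ∀ {x y} → NonAdjacent x y → NonAdjacent y x
  nonAdjacent-sym {x} {y} (¬e , ¬lab) =
    ¬e ∘ E-sym Hk , ¬lab ∘ subst IsLabel (+-comm (L y) (L x))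

  adjacency-of-nonAdjacent : ∀ {x y} → NonAdjacent x y → Adjacency x y
  adjacency-of-nonAdjacent (¬e , ¬lab) = ⇔-of-¬ ¬e ¬lab

  adjacency-GG : ∀ g h → g ≢ h → Adjacency (inG g) (inG h)
  adjacency-GG g h g≢h =
    subst (λ s → E Hk (inG g) (inG h) ⇔ IsLabel s) (sym (cong₂ _+_ (L-inG g) (L-inG h)))
      (⇔-trans (⊕-E-↑ˡ {G ⊕ P k} {N 1} (g ↑ˡ k) (h ↑ˡ k)) (⇔-trans (⊕-E-↑ˡ {G} {P k} g h) G-adjacency))
    where
    old-sum : E (G ⊕ N 1) (o g) (o h) ⇔ (∃[ z ] l z ≡ l (o g) + l (o h))
    old-sum = l-sum (o g) (o h) (g≢h ∘ ↑ˡ-injective 1 g h)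

    G-adjacency : E G g h ⇔ IsLabel (l (o g) + l (o h))
    G-adjacency = mk⇔
      (λ e → let z , lz≡ = to old-sum (from (⊕-E-↑ˡ {G} {N 1} g h) e) in subst IsLabel lz≡ (isLabel-l z))
      (λ lab → to (⊕-E-↑ˡ {G} {N 1} g h) (from old-sum (isLabel<B⇒old lab (l+l<B (o g) (o h)))))

  ¬isLabel-l+q : ∀ g j → ¬ IsLabel (l (o g) + q j)
  ¬isLabel-l+q g zero lab =
    ⊕-¬E-↑ˡ-↑ʳ {G} {N 1} g fzero (from (l-sum (o g) w (o≢w g)) (isLabel<B⇒old lab (l+l<B (o g) w)))
  -- q₀ = a may lie on either side of l (o g), so l (o g) + q₁ falls into the gap below or above q₂ = a + q₁.
  ¬isLabel-l+q g (suc zero) with <-cmp (l (o g)) (l w)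
  ... | tri< lg<a _ _ = ¬isLabel-gap 0 {l (o g) + B} (m<n+m B (l-positive (o g))) (+-monoˡ-< B lg<a)
  ... | tri≈ _ lg≡a _ = ⊥-elim (o≢w g (l-injective lg≡a))
  ... | tri> _ _ a<lg =
    ¬isLabel-gap 1 {l (o g) + B} (+-monoˡ-< B a<lg)
      (subst (l (o g) + B <_) (+-comm (q 2) B) (+-monoˡ-< B (l<q (o g) 1)))
  ¬isLabel-l+q g (suc (suc j)) =
    ¬isLabel-gap (suc j) {l (o g) + q (suc (suc j))}
      (m<n+m (q (suc (suc j))) (l-positive (o g))) (+-monoˡ-< (q (suc (suc j))) (l<q (o g) j))

  nonAdjacent-GP : ∀ g i → NonAdjacent (inG g) (inP i)
  nonAdjacent-GP g i =
    ⊕-¬E-↑ˡ-↑ʳ {G} {P k} g i ∘ to (⊕-E-↑ˡ {G ⊕ P k} {N 1} (g ↑ˡ k) (n ↑ʳ i)) ,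
    ¬isLabel-l+q g (toℕ i) ∘ subst IsLabel (cong₂ _+_ (L-inG g) (L-inP i))

  nonAdjacent-GN : ∀ g → NonAdjacent (inG g) inN
  nonAdjacent-GN g =
    ⊕-¬E-↑ˡ-↑ʳ {G ⊕ P k} {N 1} (g ↑ˡ k) fzero ,
    ¬isLabel-above (subst (q k <_) (sym (cong₂ _+_ (L-inG g) L-inN)) (m<n+m (q k) (l-positive (o g))))

  nonAdjacent-PN : ∀ i → NonAdjacent (inP i) inN
  nonAdjacent-PN i =
    ⊕-¬E-↑ˡ-↑ʳ {G ⊕ P k} {N 1} (n ↑ʳ i) fzero ,
    ¬isLabel-above (subst (q k <_) (sym (cong₂ _+_ (L-inP i) L-inN)) (m<n+m (q k) (q-positive (toℕ i))))

  isLabel-consecutive : ∀ {b d} → suc b ≡ d → d < k → IsLabel (q b + q d)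
  isLabel-consecutive {b} refl d<k = isLabel-q {suc (suc b)} d<k

  consecutive-if-isLabel : ∀ {b d} → b < d → IsLabel (q b + q d) → suc b ≡ d
  consecutive-if-isLabel {b} b<d lab with m≤n⇒m<n∨m≡n b<d
  ... | inj₂ 1+b≡d                      = 1+b≡d
  ... | inj₁ (s≤s (s≤s {n = c} b≤c)) =
    ⊥-elim (¬isLabel-gap (suc c) {q b + q (suc (suc c))}
      (m<n+m (q (suc (suc c))) (q-positive b)) (+-monoˡ-< (q (suc (suc c))) (q-strictMono (s≤s b≤c))) lab)

  path-adjacency : ∀ i j → i ≢ j → E (P k) i j ⇔ IsLabel (q (toℕ i) + q (toℕ j))
  path-adjacency i j i≢j = mk⇔ to′ from′
    where
    to′ : E (P k) i j → IsLabel (q (toℕ i) + q (toℕ j))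
    to′ (inj₁ 1+i≡j) = isLabel-consecutive 1+i≡j (toℕ<n j)
    to′ (inj₂ 1+j≡i) = subst IsLabel (+-comm (q (toℕ j)) (q (toℕ i))) (isLabel-consecutive 1+j≡i (toℕ<n i))

    from′ : IsLabel (q (toℕ i) + q (toℕ j)) → E (P k) i j
    from′ lab with <-cmp (toℕ i) (toℕ j)
    ... | tri< i<j _ _ = inj₁ (consecutive-if-isLabel i<j lab)
    ... | tri≈ _ i≡j _ = ⊥-elim (i≢j (toℕ-injective i≡j))
    ... | tri> _ _ j<i = inj₂ (consecutive-if-isLabel j<i (subst IsLabel (+-comm (q (toℕ i)) (q (toℕ j))) lab))

  adjacency-PP : ∀ i j → i ≢ j → Adjacency (inP i) (inP j)
  adjacency-PP i j i≢j =
    subst (λ s → E Hk (inP i) (inP j) ⇔ IsLabel s) (sym (cong₂ _+_ (L-inP i) (L-inP j)))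
      (⇔-trans (⊕-E-↑ˡ {G ⊕ P k} {N 1} (n ↑ʳ i) (n ↑ʳ j)) (⇔-trans (⊕-E-↑ʳ {G} {P k} i j) (path-adjacency i j i≢j)))

  L-adjacency : ∀ x y → x ≢ y → Adjacency x y
  L-adjacency x y x≢y with piece x | piece y
  ... | G-vertex g | G-vertex h = adjacency-GG g h (x≢y ∘ cong inG)
  ... | G-vertex g | P-vertex i = adjacency-of-nonAdjacent (nonAdjacent-GP g i)
  ... | G-vertex g | N-vertex   = adjacency-of-nonAdjacent (nonAdjacent-GN g)
  ... | P-vertex i | G-vertex g = adjacency-of-nonAdjacent (nonAdjacent-sym (nonAdjacent-GP g i))
  ... | P-vertex i | P-vertex j = adjacency-PP i j (x≢y ∘ cong inP)
  ... | P-vertex i | N-vertex   = adjacency-of-nonAdjacent (nonAdjacent-PN i)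
  ... | N-vertex   | G-vertex g = adjacency-of-nonAdjacent (nonAdjacent-sym (nonAdjacent-GN g))
  ... | N-vertex   | P-vertex i = adjacency-of-nonAdjacent (nonAdjacent-sym (nonAdjacent-PN i))
  ... | N-vertex   | N-vertex   = ⊥-elim (x≢y refl)

  L-positive : ∀ x → 0 < L x
  L-positive x with piece x
  ... | G-vertex g = subst (0 <_) (sym (L-inG g)) (l-positive (o g))
  ... | P-vertex i = subst (0 <_) (sym (L-inP i)) (q-positive (toℕ i))
  ... | N-vertex   = subst (0 <_) (sym L-inN) (q-positive k)

  l∘o≢q : ∀ g m → l (o g) ≢ q m
  l∘o≢q g zero    = o≢w g ∘ l-injective
  l∘o≢q g (suc m) = <⇒≢ (l<q (o g) m)

  q∘toℕ≢q-k : ∀ (i : Fin k) → q (toℕ i) ≢ q k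
  q∘toℕ≢q-k i = <⇒≢ (q-strictMono (toℕ<n i))

  relabel : ∀ {x y s t} → L x ≡ L y → L x ≡ s → L y ≡ t → s ≡ t
  relabel Lx≡Ly Lx≡s Ly≡t = trans (sym Lx≡s) (trans Lx≡Ly Ly≡t)

  L-injective : Injective _≡_ _≡_ L
  L-injective {x} {y} Lx≡Ly with piece x | piece y
  ... | G-vertex g | G-vertex h = cong inG (↑ˡ-injective 1 g h (l-injective (relabel Lx≡Ly (L-inG g) (L-inG h))))
  ... | G-vertex g | P-vertex i = ⊥-elim (l∘o≢q g (toℕ i) (relabel Lx≡Ly (L-inG g) (L-inP i)))
  ... | G-vertex g | N-vertex   = ⊥-elim (l∘o≢q g k (relabel Lx≡Ly (L-inG g) L-inN))
  ... | P-vertex i | G-vertex g = ⊥-elim (l∘o≢q g (toℕ i) (sym (relabel Lx≡Ly (L-inP i) (L-inG g))))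
  ... | P-vertex i | P-vertex j = cong inP (toℕ-injective (q-injective (relabel Lx≡Ly (L-inP i) (L-inP j))))
  ... | P-vertex i | N-vertex   = ⊥-elim (q∘toℕ≢q-k i (relabel Lx≡Ly (L-inP i) L-inN))
  ... | N-vertex   | G-vertex g = ⊥-elim (l∘o≢q g k (sym (relabel Lx≡Ly L-inN (L-inG g))))
  ... | N-vertex   | P-vertex i = ⊥-elim (q∘toℕ≢q-k i (sym (relabel Lx≡Ly L-inN (L-inP i))))
  ... | N-vertex   | N-vertex   = refl

  isSumGraph : IsSumGraph Hk
  isSumGraph = L , (λ x → >-nonZero (L-positive x)) , L-injective , L-adjacency

IsSumGraph-⊕-P : (G : Graph) → IsSumGraph (G ⊕ N 1) → ∀ k → 1 ≤ k → IsSumGraph ((G ⊕ P k) ⊕ N 1)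
IsSumGraph-⊕-P G (l , l-nonZero , l-injective , l-sum) k 1≤k
  with argmax-Fin l (V G ↑ʳ fzero)
... | x , l≤lx = PathExtension.isSumGraph G k 1≤k l l-nonZero l-injective l-sum (l x) l≤lx

proposition21 : (G : Graph) → NoIsolated G → HasSumNumber G 1 →
                (k : ℕ) → 2 ≤ k → HasSumNumber (G ⊕ P k) 1
proposition21 G noIsolated (sum-G+N₁ , _) k 2≤k =
  IsSumGraph-⊕-P G sum-G+N₁ k 1≤k ,
  σ-positive (G ⊕ P k) (NoIsolated-⊕ {G} {P k} noIsolated (NoIsolated-P 2≤k)) (V G ↑ʳ fromℕ< 1≤k)
  where
  1≤k : 1 ≤ k
  1≤k = ≤-trans (s≤s z≤n) 2≤k
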